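{- Let $\varepsilon$, $\chi_4$, $\chi_8$ be as in the context, and for a subset $S\subseteq GL_2(\mathbb{Z}/2^k\mathbb{Z})$ write $S_r=\{g\in S:\mathrm{tr}\,g\equiv r\bmod 2^k\}$. (i) For $\psi_2=\varepsilon$ on $GL_2(\mathbb{Z}/2\mathbb{Z})$: $|\psi_2^{ -1}(1)_0|=1$, $|\psi_2^{ -1}(-1)_0|=3$, $|\psi_2^{ -1}(1)_1|=2$, $|\psi_2^{ -1}(-1)_1|=0$. (ii) For $\psi_4(\sigma)=\chi_4(\det\sigma)\varepsilon(\sigma)$ on $GL_2(\mathbb{Z}/4\mathbb{Z})$: $|\psi_4^{ -1}(1)_0|=|\psi_4^{ -1}(-1)_2|=12$, $|\psi_4^{ -1}(-1)_0|=|\psi_4^{ -1}(1)_2|=20$, and $|\psi_4^{ -1}(\pm1)_r|=8$ for odd $r$. (iii) Let $\Delta$ be a squarefree integer with $\Delta\equiv2\bmod4$, and on $GL_2(\mathbb{Z}/8\mathbb{Z})$ let $\psi_8(\sigma)=\chi_8(\det\sigma)\varepsilon(\sigma)$ if $\Delta\equiv2\bmod8$ and $\psi_8(\sigma)=\chi_4(\det\sigma)\chi_8(\det\sigma)\varepsilon(\sigma)$ if $\Delta\equiv6\bmod8$. Then $|\psi_8^{ -1}(\pm1)_r|=16\cdot8$ if $r\equiv2\bmod4$ and $=16\cdot4$ if $r$ is odd; $|\psi_8^{ -1}(1)_0|=|\psi_8^{ -1}(-1)_4|$ equals $16\cdot9$ if $\Delta\equiv2\bmod8$ and $16\cdot7$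 if $\Delta\equiv6\bmod8$; and $|\psi_8^{ -1}(-1)_0|=|\psi_8^{ -1}(1)_4|$ equals $16\cdot7$ if $\Delta\equiv2\bmod8$ and $16\cdot9$ if $\Delta\equiv6\bmod8$.
   Context: $\varepsilon:GL_2(\mathbb{Z}/2^k\mathbb{Z})\to\{\pm1\}$ is reduction mod 2 to $GL_2(\mathbb{Z}/2\mathbb{Z})\cong S_3$ (acting on the three nonzero vectors of $(\mathbb{Z}/2\mathbb{Z})^2$) followed by the sign character. $\chi_4$ is the nontrivial Dirichlet character mod 4 and $\chi_8$ is the Dirichlet character mod 8 given by $\chi_8(d)=(-1)^{(d^2-1)/8}$ for odd $d$ (the character of $\mathbb{Q}(\sqrt2)$). -}

module Defs where

open import Data.Nat as ℕ using (ℕ; zero; suc; NonZero)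
open import Data.Nat.Divisibility using (_∣_)
open import Data.Nat.DivMod as ℕD using ()
open import Data.Integer as ℤ using (ℤ; +_; ∣_∣)
open import Data.Integer.DivMod using (_%ℕ_)
open import Data.Fin using (Fin; toℕ) renaming (zero to f0; suc to fs)
open import Data.Fin.Properties using (_<?_)
open import Data.Bool using (Bool; true; false; if_then_else_; _∧_)
open import Data.List using (List; []; _∷_; allFin; concatMap; map; filterᵇ; length)
open import Data.Bool.ListAction using (any)
open import Data.Sign using (Sign) renaming (_*_ to _·_)
import Data.Sign as S
open import Data.Product using (_×_; _,_)
open import Relation.Binary.PropositionalEquality using (_≡_)
open import Relation.Nullary.Decidable using (⌊_⌋)

-- Z/mZ with representatives Fin m; 2x2 matrices over Z/mZ as (a,b,c,d)
-- meaning [[a,b],[c,d]].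

Mat : ℕ → Set
Mat m = Fin m × Fin m × Fin m × Fin m

allMats : (m : ℕ) → List (Mat m)
allMats m = concatMap (λ a → concatMap (λ b → concatMap (λ c →
  map (λ d → (a , b , c , d)) (allFin m)) (allFin m)) (allFin m)) (allFin m)

det : ∀ {m} .{{_ : NonZero m}} → Mat m → ℕ
det {m} (a , b , c , d) = (+ (toℕ a ℕ.* toℕ d) ℤ.- + (toℕ b ℕ.* toℕ c)) %ℕ m

isUnit : (m : ℕ) .{{_ : NonZero m}} → ℕ → Bool
isUnit m x = any (λ y → ⌊ ((x ℕ.* toℕ y) ℕ.% m) ℕ.≟ (1 ℕ.% m) ⌋) (allFin m)

isGL : ∀ {m} .{{_ : NonZero m}} → Mat m → Bool
isGL {m} g = isUnit m (det g)

trIs : ∀ {m} .{{_ : NonZero m}} → ℤ → Mat m → Bool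
trIs {m} r (a , b , c , d) = ⌊ ((+ (toℕ a ℕ.+ toℕ d) ℤ.- r) %ℕ m) ℕ.≟ 0 ⌋

-- ε : reduction mod 2, action on the three nonzero vectors of F_2^2,
-- followed by the sign of the resulting permutation of those vectors.

vec : Fin 3 → ℕ × ℕ
vec f0 = 1 , 0
vec (fs f0) = 0 , 1
vec (fs (fs f0)) = 1 , 1

-- index of a vector of F_2^2 (entries 0/1); the zero vector is never hit
-- by an invertible matrix, it is sent to index 0 arbitrarily
idx : ℕ × ℕ → Fin 3
idx (1 , 0) = f0
idx (0 , 1) = fs f0
idx (1 , 1) = fs (fs f0)
idx _ = f0

act : ∀ {m} → Mat m → Fin 3 → Fin 3
act (a , b , c , d) i with vec i
... | (x , y) = idx ((toℕ a ℕ.* x ℕ.+ toℕ b ℕ.* y) ℕ.% 2 ,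
                     (toℕ c ℕ.* x ℕ.+ toℕ d ℕ.* y) ℕ.% 2)

inversions : (Fin 3 → Fin 3) → ℕ
inversions π = length (filterᵇ (λ { (i , j) → ⌊ i <? j ⌋ ∧ ⌊ π j <? π i ⌋ })
  (concatMap (λ i → map (λ j → (i , j)) (allFin 3)) (allFin 3)))

signPerm : (Fin 3 → Fin 3) → Sign
signPerm π = if ⌊ (inversions π ℕ.% 2) ℕ.≟ 0 ⌋ then S.+ else S.-

ε : ∀ {m} → Mat m → Sign
ε g = signPerm (act g)

-- χ₄(d) = (-1)^((d-1)/2) for odd d  (nontrivial character mod 4)
χ₄ : ℕ → Sign
χ₄ d = if ⌊ ((d ℕ.% 4) ℕ.≟ 1) ⌋ then S.+ else S.-

χ₈ : ℕ → Sign
χ₈ d = if ⌊ ((((d ℕ.* d) ℕ.∸ 1) ℕ./ 8) ℕ.% 2) ℕ.≟ 0 ⌋ then S.+ else S.-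

ψ₂ : Mat 2 → Sign
ψ₂ g = ε g

ψ₄ : Mat 4 → Sign
ψ₄ g = χ₄ (det g) · ε g

-- depends on Δ mod 8 (Δ ≡ 2 or 6 mod 8; other cases unused)
ψ₈ : ℤ → Mat 8 → Sign
ψ₈ Δ g = if ⌊ (Δ %ℕ 8) ℕ.≟ 2 ⌋
           then χ₈ (det g) · ε g
           else (χ₄ (det g) · χ₈ (det g)) · ε g

count : (m : ℕ) .{{_ : NonZero m}} → (Mat m → Sign) → Sign → ℤ → ℕ
count m ψ s r = length (filterᵇ (λ g → isGL g ∧ (⌊ ψ g S.≟ s ⌋ ∧ trIs r g)) (allMats m))

Squarefree : ℤ → Set
Squarefree Δ = ∀ (n : ℕ) → (n ℕ.* n) ∣ ∣ Δ ∣ → n ≡ 1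

module Submission where

-- Every number in the lemma counts the matrices of a finite group GL₂(ℤ/mℤ)
-- (m = 2, 4, 8) with a prescribed character value and trace, so each single
-- instance is a finite computation that Agda carries out by evaluation.  The
-- mathematical content of the proof is the reduction of the infinitely many
-- instances (all traces r ∈ ℤ, all Δ ∈ ℤ) to finitely many:
--   * residues _%ℕ_ of integers are invariant under adding multiples of the
--     modulus; hence trIs r, and with it count m ψ s r, depends only on
--     r mod m, and r mod d is determined by r mod m whenever d ∣ m;
--   * ψ₈ Δ depends only on Δ mod 8, which is 2 or 6 when Δ ≡ 2 mod 4.
-- The file first develops this residue arithmetic, then the invariance of
-- the counts, then tabulates the finitely many remaining counts, and finally
-- assembles parts (i)-(iii).

open import Defs
open import Data.Nat as Nat using (ℕ; zero; suc; NonZero; _∸_; _<_; z≤n; s≤s; _≟_)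
import Data.Nat.Properties as ℕP
open import Data.Nat.DivMod
  using (_%_; [m+n]%n≡m%n; m<n⇒m%n≡m; n%n≡0; m≤n⇒[n∸m]%m≡n%m)
open import Data.Nat.Divisibility using (_∣_; divides)
open import Data.Integer as Int using (ℤ; +_; -[1+_])
import Data.Integer.Properties as ℤP
open import Data.Integer.DivMod using (_%ℕ_; _/ℕ_; a≡a%ℕn+[a/ℕn]*n; n%ℕd<d)
open import Data.Integer.Tactic.RingSolver using (solve-∀)
open import Data.Bool using (Bool; T; _∧_; if_then_else_)
open import Data.Bool.Properties using (T?)
open import Function using (_∘_)
open import Data.List using (length)
open import Data.List.Properties using (filter-≐)
open import Data.Product using (_×_; _,_)
open import Data.Sign using (Sign) renaming (_*_ to _·_)
import Data.Sign as Sign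
open import Data.Fin using (toℕ)
open import Relation.Binary using (tri<; tri≈; tri>)
open import Relation.Binary.PropositionalEquality
open import Relation.Nullary using (contradiction)
open import Relation.Nullary.Decidable using (⌊_⌋)

-- The integer operations are opened only here, so that _*_
-- denotes multiplication of naturals in the rest of the file.
module IntegerResidues where
  open Int using (_⊖_; _+_; _-_; _*_; -_)

  module _ {n : ℕ} .{{_ : NonZero n}} where

    negResidue : ℕ → ℕ
    negResidue zero    = 0
    negResidue (suc r) = n ∸ suc r

    -[1+]%ℕ : ∀ m → -[1+ m ] %ℕ n ≡ negResidue (suc m % n)
    -[1+]%ℕ m with suc m % n
    ... | zero  = refl
    ... | suc _ = refl

    [i+n]%ℕn≡i%ℕn : ∀ i → (i + + n) %ℕ n ≡ i %ℕ n
    [i+n]%ℕn≡i%ℕn (+ m) = [m+n]%n≡m%n m n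
    [i+n]%ℕn≡i%ℕn -[1+ m ] with ℕP.<-cmp (suc m) n
    ... | tri< 1+m<n _ _ = begin
      (n ⊖ suc m) %ℕ n        ≡⟨ cong (_%ℕ n) (ℤP.⊖-≥ (ℕP.<⇒≤ 1+m<n)) ⟩
      (n ∸ suc m) % n         ≡⟨ m<n⇒m%n≡m (ℕP.∸-monoʳ-< (s≤s z≤n) (ℕP.<⇒≤ 1+m<n)) ⟩
      negResidue (suc m)      ≡⟨ cong negResidue (sym (m<n⇒m%n≡m 1+m<n)) ⟩
      negResidue (suc m % n)  ≡⟨ sym (-[1+]%ℕ m) ⟩
      -[1+ m ] %ℕ n           ∎
      where open ≡-Reasoning
    ... | tri≈ _ refl _ = begin
      (suc m ⊖ suc m) %ℕ n        ≡⟨ cong (_%ℕ n) (ℤP.n⊖n≡0 (suc m)) ⟩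
      negResidue 0                ≡⟨ cong negResidue (sym (n%n≡0 (suc m))) ⟩
      negResidue (suc m % suc m)  ≡⟨ sym (-[1+]%ℕ m) ⟩
      -[1+ m ] %ℕ n               ∎
      where open ≡-Reasoning
    ... | tri> _ _ n<1+m = begin
      (n ⊖ suc m) %ℕ n              ≡⟨ cong (_%ℕ n) (ℤP.⊖-< n<1+m) ⟩
      - + (suc m ∸ n) %ℕ n          ≡⟨ cong (λ k → - + k %ℕ n) 1+m∸n≡1+[m∸n] ⟩
      -[1+ m ∸ n ] %ℕ n             ≡⟨ -[1+]%ℕ (m ∸ n) ⟩
      negResidue (suc (m ∸ n) % n)  ≡⟨ cong (λ k → negResidue (k % n)) (sym 1+m∸n≡1+[m∸n]) ⟩
      negResidue ((suc m ∸ n) % n)  ≡⟨ cong negResidue (m≤n⇒[n∸m]%m≡n%m (ℕP.<⇒≤ n<1+m)) ⟩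
      negResidue (suc m % n)        ≡⟨ sym (-[1+]%ℕ m) ⟩
      -[1+ m ] %ℕ n                 ∎
      where open ≡-Reasoning
            1+m∸n≡1+[m∸n] : suc m ∸ n ≡ suc (m ∸ n)
            1+m∸n≡1+[m∸n] = ℕP.+-∸-assoc 1 (ℕP.≤-pred n<1+m)

    [i+q*n]%ℕn≡i%ℕn⁺ : ∀ i q → (i + + q * + n) %ℕ n ≡ i %ℕ n
    [i+q*n]%ℕn≡i%ℕn⁺ i zero    = cong (_%ℕ n) (ℤP.+-identityʳ i)
    [i+q*n]%ℕn≡i%ℕn⁺ i (suc q) = begin
      (i + + suc q * + n) %ℕ n    ≡⟨ cong (_%ℕ n) (peel i (+ q) (+ n)) ⟩
      (i + + q * + n + + n) %ℕ n  ≡⟨ [i+n]%ℕn≡i%ℕn (i + + q * + n) ⟩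
      (i + + q * + n) %ℕ n        ≡⟨ [i+q*n]%ℕn≡i%ℕn⁺ i q ⟩
      i %ℕ n                      ∎
      where open ≡-Reasoning
            peel : ∀ i q n → i + (+ 1 + q) * n ≡ i + q * n + n
            peel = solve-∀

    [i+q*n]%ℕn≡i%ℕn : ∀ i q → (i + q * + n) %ℕ n ≡ i %ℕ n
    [i+q*n]%ℕn≡i%ℕn i (+ q)          = [i+q*n]%ℕn≡i%ℕn⁺ i q
    [i+q*n]%ℕn≡i%ℕn i q@(-[1+ m ]) = begin
      (i + q * + n) %ℕ n             ≡⟨ sym ([i+q*n]%ℕn≡i%ℕn⁺ (i + q * + n) (suc m)) ⟩
      (i + q * + n + - q * + n) %ℕ n ≡⟨ cong (_%ℕ n) (cancel i q (+ n)) ⟩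
      i %ℕ n                         ∎
      where open ≡-Reasoning
            cancel : ∀ i q n → i + q * n + - q * n ≡ i
            cancel = solve-∀

    [t-r]%ℕn≡[t-r%ℕn]%ℕn : ∀ t r → (t - r) %ℕ n ≡ (t - + (r %ℕ n)) %ℕ n
    [t-r]%ℕn≡[t-r%ℕn]%ℕn t r = begin
      (t - r) %ℕ n                ≡⟨ cong (λ x → (t - x) %ℕ n) (a≡a%ℕn+[a/ℕn]*n r n) ⟩
      (t - (ρ + q * + n)) %ℕ n    ≡⟨ cong (_%ℕ n) (split t ρ q (+ n)) ⟩
      (t - ρ + - q * + n) %ℕ n    ≡⟨ [i+q*n]%ℕn≡i%ℕn (t - ρ) (- q) ⟩
      (t - ρ) %ℕ n                ∎
      where open ≡-Reasoning
            ρ q : ℤ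
            ρ = + (r %ℕ n)
            q = r /ℕ n
            split : ∀ t ρ q n → t - (ρ + q * n) ≡ t - ρ + - q * n
            split = solve-∀

  %ℕ-%-divisor : ∀ {d n} .{{_ : NonZero d}} .{{_ : NonZero n}} → d ∣ n →
                 ∀ r → (r %ℕ n) % d ≡ r %ℕ d
  %ℕ-%-divisor {d} {n} (divides k n≡k*d) r = sym (begin
    r %ℕ d                        ≡⟨ cong (_%ℕ d) (a≡a%ℕn+[a/ℕn]*n r n) ⟩
    (ρ + q * + n) %ℕ d            ≡⟨ cong (λ x → (ρ + q * x) %ℕ d) +n≡+k*+d ⟩
    (ρ + q * (+ k * + d)) %ℕ d    ≡⟨ cong (_%ℕ d) (regroup ρ q (+ k) (+ d)) ⟩
    (ρ + q * + k * + d) %ℕ d      ≡⟨ [i+q*n]%ℕn≡i%ℕn ρ (q * + k) ⟩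
    (r %ℕ n) % d                  ∎)
    where open ≡-Reasoning
          ρ q : ℤ
          ρ = + (r %ℕ n)
          q = r /ℕ n
          +n≡+k*+d : + n ≡ + k * + d
          +n≡+k*+d = trans (cong +_ n≡k*d) (ℤP.pos-* k d)
          regroup : ∀ ρ q k d → ρ + q * (k * d) ≡ ρ + q * k * d
          regroup = solve-∀

open IntegerResidues
open Nat using (_*_)

count-cong : ∀ {m} .{{_ : NonZero m}} {ψ ψ′ : Mat m → Sign} {s r r′} →
             (∀ g → ψ g ≡ ψ′ g) → (∀ g → trIs r g ≡ trIs r′ g) →
             count m ψ s r ≡ count m ψ′ s r′
count-cong {m} {ψ} {ψ′} {s} {r} {r′} ψ≗ψ′ tr≗tr′ =
  cong length (filter-≐ (T? ∘ select) (T? ∘ select′)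
                        ((λ {g} → subst T (same g)) , (λ {g} → subst T (sym (same g))))
                        (allMats m))
  where
  select select′ : Mat m → Bool
  select  g = isGL g ∧ (⌊ ψ g Sign.≟ s ⌋ ∧ trIs r g)
  select′ g = isGL g ∧ (⌊ ψ′ g Sign.≟ s ⌋ ∧ trIs r′ g)
  same : ∀ g → select g ≡ select′ g
  same g = cong₂ (λ u v → isGL g ∧ (⌊ u Sign.≟ s ⌋ ∧ v)) (ψ≗ψ′ g) (tr≗tr′ g)

trIs-residue : ∀ {m} .{{_ : NonZero m}} r (g : Mat m) → trIs r g ≡ trIs (+ (r %ℕ m)) g
trIs-residue r (a , b , c , d) =
  cong (λ x → ⌊ x ≟ 0 ⌋) ([t-r]%ℕn≡[t-r%ℕn]%ℕn (+ (toℕ a Nat.+ toℕ d)) r)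

count-residue : ∀ {m} .{{_ : NonZero m}} ψ s r → count m ψ s r ≡ count m ψ s (+ (r %ℕ m))
count-residue {m} ψ s r = count-cong {ψ = ψ} {ψ} {s} {r} {+ (r %ℕ m)} (λ _ → refl) (trIs-residue r)

ψ₈-residue : ∀ Δ Δ′ → Δ %ℕ 8 ≡ Δ′ %ℕ 8 → ∀ g → ψ₈ Δ g ≡ ψ₈ Δ′ g
ψ₈-residue _ _ Δ≡Δ′ g =
  cong (λ δ → if ⌊ δ ≟ 2 ⌋ then χ₈ (det g) · ε g else (χ₄ (det g) · χ₈ (det g)) · ε g) Δ≡Δ′

count₈-residue : ∀ Δ {k} → Δ %ℕ 8 ≡ k → ∀ s r →
                 count 8 (ψ₈ Δ) s r ≡ count 8 (ψ₈ (+ k)) s (+ (r %ℕ 8))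
count₈-residue Δ {k} Δ≡k s r =
  trans (count-cong {ψ = ψ₈ Δ} {ψ₈ (+ k)} {s} {r} {r} (ψ₈-residue Δ (+ k) Δ≡k%8) (λ _ → refl))
        (count-residue (ψ₈ (+ k)) s r)
  where
  Δ≡k%8 : Δ %ℕ 8 ≡ k % 8
  Δ≡k%8 = trans (sym (m<n⇒m%n≡m (n%ℕd<d Δ 8))) (cong (_% 8) Δ≡k)

data TwoMod4 : ℕ → Set where
  two : TwoMod4 2
  six : TwoMod4 6

data Odd₄ : ℕ → Set where
  one   : Odd₄ 1
  three : Odd₄ 3

data Odd₈ : ℕ → Set where
  one   : Odd₈ 1
  three : Odd₈ 3
  five  : Odd₈ 5
  seven : Odd₈ 7

twoMod4 : ∀ j → j < 8 → j % 4 ≡ 2 → TwoMod4 j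
twoMod4 2 _ _ = two
twoMod4 6 _ _ = six
twoMod4 0 _ ()
twoMod4 1 _ ()
twoMod4 3 _ ()
twoMod4 4 _ ()
twoMod4 5 _ ()
twoMod4 7 _ ()
twoMod4 (suc (suc (suc (suc (suc (suc (suc (suc _)))))))) (s≤s (s≤s (s≤s (s≤s (s≤s (s≤s (s≤s (s≤s ())))))))) _

odd₄ : ∀ j → j < 4 → j % 2 ≡ 1 → Odd₄ j
odd₄ 1 _ _ = one
odd₄ 3 _ _ = three
odd₄ 0 _ ()
odd₄ 2 _ ()
odd₄ (suc (suc (suc (suc _)))) (s≤s (s≤s (s≤s (s≤s ())))) _

odd₈ : ∀ j → j < 8 → j % 2 ≡ 1 → Odd₈ j
odd₈ 1 _ _ = one
odd₈ 3 _ _ = three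
odd₈ 5 _ _ = five
odd₈ 7 _ _ = seven
odd₈ 0 _ ()
odd₈ 2 _ ()
odd₈ 4 _ ()
odd₈ 6 _ ()
odd₈ (suc (suc (suc (suc (suc (suc (suc (suc _)))))))) (s≤s (s≤s (s≤s (s≤s (s≤s (s≤s (s≤s (s≤s ())))))))) _

bothSigns : {P : Sign → Set} → P Sign.+ → P Sign.- → ∀ s → P s
bothSigns p₊ p₋ Sign.+ = p₊
bothSigns p₊ p₋ Sign.- = p₋

odd-trace₄ : ∀ {j} → Odd₄ j → ∀ s → count 4 ψ₄ s (+ j) ≡ 8
odd-trace₄ one   = bothSigns refl refl
odd-trace₄ three = bothSigns refl refl

odd-traces₄ : ∀ s r → r %ℕ 2 ≡ 1 → count 4 ψ₄ s r ≡ 8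
odd-traces₄ s r r-odd = trans (count-residue ψ₄ s r)
  (odd-trace₄ (odd₄ (r %ℕ 4) (n%ℕd<d r 4) (trans (%ℕ-%-divisor (divides 2 refl) r) r-odd)) s)

trace-2mod4₈ : ∀ {k j} → TwoMod4 k → TwoMod4 j → ∀ s → count 8 (ψ₈ (+ k)) s (+ j) ≡ 16 * 8
trace-2mod4₈ two two = bothSigns refl refl
trace-2mod4₈ two six = bothSigns refl refl
trace-2mod4₈ six two = bothSigns refl refl
trace-2mod4₈ six six = bothSigns refl refl

trace-odd₈ : ∀ {k j} → TwoMod4 k → Odd₈ j → ∀ s → count 8 (ψ₈ (+ k)) s (+ j) ≡ 16 * 4
trace-odd₈ two one   = bothSigns refl refl
trace-odd₈ two three = bothSigns refl refl
trace-odd₈ two five  = bothSigns refl refl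
trace-odd₈ two seven = bothSigns refl refl
trace-odd₈ six one   = bothSigns refl refl
trace-odd₈ six three = bothSigns refl refl
trace-odd₈ six five  = bothSigns refl refl
trace-odd₈ six seven = bothSigns refl refl

record Traces0and4 (c : Sign → ℤ → ℕ) (a b : ℕ) : Set where
  field
    plus₀  : c Sign.+ (+ 0) ≡ a
    minus₀ : c Sign.- (+ 0) ≡ b
    minus₄ : c Sign.- (+ 4) ≡ a
    plus₄  : c Sign.+ (+ 4) ≡ b

traces0and4-Δ≡2 : Traces0and4 (count 8 (ψ₈ (+ 2))) (16 * 9) (16 * 7)
traces0and4-Δ≡2 = record { plus₀ = refl ; minus₀ = refl ; minus₄ = refl ; plus₄ = refl }

traces0and4-Δ≡6 : Traces0and4 (count 8 (ψ₈ (+ 6))) (16 * 7) (16 * 9)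
traces0and4-Δ≡6 = record { plus₀ = refl ; minus₀ = refl ; minus₄ = refl ; plus₄ = refl }

traces0and4 : ∀ Δ {k a b} → Δ %ℕ 8 ≡ k →
              Traces0and4 (count 8 (ψ₈ (+ k))) a b → Traces0and4 (count 8 (ψ₈ Δ)) a b
traces0and4 Δ Δ≡k t = record
  { plus₀  = trans (count₈-residue Δ Δ≡k Sign.+ (+ 0)) plus₀
  ; minus₀ = trans (count₈-residue Δ Δ≡k Sign.- (+ 0)) minus₀
  ; minus₄ = trans (count₈-residue Δ Δ≡k Sign.- (+ 4)) minus₄
  ; plus₄  = trans (count₈-residue Δ Δ≡k Sign.+ (+ 4)) plus₄
  }
  where open Traces0and4 t

traces-2mod4₈ : ∀ Δ {k} → Δ %ℕ 8 ≡ k → TwoMod4 k →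
                ∀ s r → r %ℕ 4 ≡ 2 → count 8 (ψ₈ Δ) s r ≡ 16 * 8
traces-2mod4₈ Δ Δ≡k k̂ s r r≡2 = trans (count₈-residue Δ Δ≡k s r)
  (trace-2mod4₈ k̂ (twoMod4 (r %ℕ 8) (n%ℕd<d r 8) (trans (%ℕ-%-divisor (divides 2 refl) r) r≡2)) s)

traces-odd₈ : ∀ Δ {k} → Δ %ℕ 8 ≡ k → TwoMod4 k →
              ∀ s r → r %ℕ 2 ≡ 1 → count 8 (ψ₈ Δ) s r ≡ 16 * 4
traces-odd₈ Δ Δ≡k k̂ s r r-odd = trans (count₈-residue Δ Δ≡k s r)
  (trace-odd₈ k̂ (odd₈ (r %ℕ 8) (n%ℕd<d r 8) (trans (%ℕ-%-divisor (divides 4 refl) r) r-odd)) s)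

Part-iii : ℤ → Set
Part-iii Δ =
  (∀ (s : Sign) (r : ℤ) → r %ℕ 4 ≡ 2 → count 8 (ψ₈ Δ) s r ≡ 16 * 8)
  × (∀ (s : Sign) (r : ℤ) → r %ℕ 2 ≡ 1 → count 8 (ψ₈ Δ) s r ≡ 16 * 4)
  × count 8 (ψ₈ Δ) Sign.+ (+ 0) ≡ count 8 (ψ₈ Δ) Sign.- (+ 4)
  × count 8 (ψ₈ Δ) Sign.- (+ 0) ≡ count 8 (ψ₈ Δ) Sign.+ (+ 4)
  × (Δ %ℕ 8 ≡ 2 → count 8 (ψ₈ Δ) Sign.+ (+ 0) ≡ 16 * 9
                   × count 8 (ψ₈ Δ) Sign.- (+ 0) ≡ 16 * 7)
  × (Δ %ℕ 8 ≡ 6 → count 8 (ψ₈ Δ) Sign.+ (+ 0) ≡ 16 * 7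
                   × count 8 (ψ₈ Δ) Sign.- (+ 0) ≡ 16 * 9)

part-iii : ∀ Δ {k} → Δ %ℕ 8 ≡ k → TwoMod4 k → Part-iii Δ
part-iii Δ Δ≡2 two =
  traces-2mod4₈ Δ Δ≡2 two , traces-odd₈ Δ Δ≡2 two ,
  trans plus₀ (sym minus₄) , trans minus₀ (sym plus₄) ,
  (λ _ → plus₀ , minus₀) , (λ Δ≡6 → contradiction (trans (sym Δ≡2) Δ≡6) λ ())
  where open Traces0and4 (traces0and4 Δ Δ≡2 traces0and4-Δ≡2)
part-iii Δ Δ≡6 six =
  traces-2mod4₈ Δ Δ≡6 six , traces-odd₈ Δ Δ≡6 six ,
  trans plus₀ (sym minus₄) , trans minus₀ (sym plus₄) ,
  (λ Δ≡2 → contradiction (trans (sym Δ≡6) Δ≡2) λ ()) , (λ _ → plus₀ , minus₀)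
  where open Traces0and4 (traces0and4 Δ Δ≡6 traces0and4-Δ≡6)

lemma5p6 : (count 2 ψ₂ Sign.+ (+ 0) ≡ 1 × count 2 ψ₂ Sign.- (+ 0) ≡ 3
    × count 2 ψ₂ Sign.+ (+ 1) ≡ 2 × count 2 ψ₂ Sign.- (+ 1) ≡ 0)
    × (count 4 ψ₄ Sign.+ (+ 0) ≡ 12 × count 4 ψ₄ Sign.- (+ 2) ≡ 12
    × count 4 ψ₄ Sign.- (+ 0) ≡ 20 × count 4 ψ₄ Sign.+ (+ 2) ≡ 20
    × (∀ (s : Sign) (r : ℤ) → r %ℕ 2 ≡ 1 → count 4 ψ₄ s r ≡ 8))
    × (∀ (Δ : ℤ) → Squarefree Δ → Δ %ℕ 4 ≡ 2 →
    (∀ (s : Sign) (r : ℤ) → r %ℕ 4 ≡ 2 → count 8 (ψ₈ Δ) s r ≡ 16 * 8)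
    × (∀ (s : Sign) (r : ℤ) → r %ℕ 2 ≡ 1 → count 8 (ψ₈ Δ) s r ≡ 16 * 4)
    × count 8 (ψ₈ Δ) Sign.+ (+ 0) ≡ count 8 (ψ₈ Δ) Sign.- (+ 4)
    × count 8 (ψ₈ Δ) Sign.- (+ 0) ≡ count 8 (ψ₈ Δ) Sign.+ (+ 4)
    × (Δ %ℕ 8 ≡ 2 → count 8 (ψ₈ Δ) Sign.+ (+ 0) ≡ 16 * 9
    × count 8 (ψ₈ Δ) Sign.- (+ 0) ≡ 16 * 7)
    × (Δ %ℕ 8 ≡ 6 → count 8 (ψ₈ Δ) Sign.+ (+ 0) ≡ 16 * 7
    × count 8 (ψ₈ Δ) Sign.- (+ 0) ≡ 16 * 9))
lemma5p6 =
  (refl , refl , refl , refl) ,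
  (refl , refl , refl , refl , odd-traces₄) ,
  -- (iii): Δ ≡ 2 mod 4 puts Δ mod 8 in the class 2 or 6.
  λ Δ _ Δ≡2[4] → part-iii Δ refl
    (twoMod4 (Δ %ℕ 8) (n%ℕd<d Δ 8) (trans (%ℕ-%-divisor (divides 2 refl) Δ) Δ≡2[4]))
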